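{- If a bi-nested sequent $S$ is provable in the calculus $\mathbf{C}_{\mathbf{LIK}}$, then $S$ is valid, i.e. $\mathcal{M},x\Vdash S$ for every model $\mathcal{M}=(W,\leq,R,V)$ based on a forward and downward confluent frame and every $x\in W$.
   Context: Formulas: $A::=p\mid A\supset A\mid \top\mid\bot\mid A\vee A\mid A\wedge A\mid \square A\mid \lozenge A$. Frames $(W,\leq,R)$: $W\ne\emptyset$, $\leq$ preorder, $R$ binary relation; forward confluent: $x\leq x'$, $Rxy$ imply some $y'$ with $Rx'y'$, $y\leq y'$; downward confluent: $x\leq x'$, $Rx'y$ imply some $z$ with $Rxz$, $z\leq y$. Models add $V$ with $\leq$-upward closed values; forcing: atoms by $V$, $\top,\bot,\wedge,\vee$ pointwise, $x\Vdash A\supset B$ iff for all $x'\geq x$, $x'\Vdash A$ implies $x'\Vdash B$; $x\Vdash\square A$ iff $y\Vdash A$ for all $y$ with $Rxy$; $x\Vdash\lozenge A$ iff $y\Vdash A$ for some $y$ with $Rxy$. Bi-nested sequents: the empty sequent $\Rightarrow$ is a sequent; $\Gamma\Rightarrow B_1,\dots,B_k,[S_1],\dots,[S_m],\langle T_1\rangle,\dots,\langle T_n\rangle$ is a sequent, where $\Gamma$ is a finite multiset of formulas, $B_i$ formulas, $S_i,T_j$ sequents ($[S]$: modal block, $\langle T\rangle$: implication block). Contexts: $\{\}$ is a context; if $\Gamma\Rightarrow\Delta$ is a sequent and $G'\{\}$ a context then $\Gamma\Rightarrow\Delta,\langle G'\{\}\rangle$ and $\Gamma\Rightarrow\Delta,[G'\{\}]$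 are contexts; $G\{S\}$ fills the hole with $S$. For a succedent $\Theta=\Theta_0,[\Phi_1\Rightarrow\Psi_1],\dots,[\Phi_k\Rightarrow\Psi_k]$ with $\Theta_0$ containing no modal blocks at top level, $\Theta^\flat=[\Phi_1\Rightarrow\Psi_1^\flat],\dots,[\Phi_k\Rightarrow\Psi_k^\flat]$ (empty if $k=0$), and $\Rightarrow\Theta^\#$ is the sequent $\Rightarrow Fm(\Theta_0),[\Rightarrow\Psi_1^\#],\dots,[\Rightarrow\Psi_k^\#]$, $Fm(\Theta_0)$ the formulas directly in $\Theta_0$. Rules of $\mathbf{C}_{\mathbf{LIK}}$ (premises / conclusion, $G$ any context): axioms $G\{\Gamma,\bot\Rightarrow\Delta\}$, $G\{\Gamma\Rightarrow\top,\Delta\}$, $G\{\Gamma,p\Rightarrow\Delta,p\}$ ($p$ atom); $(\wedge_L)$ $G\{A,B,\Gamma\Rightarrow\Delta\}$ / $G\{A\wedge B,\Gamma\Rightarrow\Delta\}$; $(\wedge_R)$ $G\{\Gamma\Rightarrow\Delta,A\}$, $G\{\Gamma\Rightarrow\Delta,B\}$ / $G\{\Gamma\Rightarrow\Delta,A\wedge B\}$; $(\vee_L)$ $G\{\Gamma,A\Rightarrow\Delta\}$, $G\{\Gamma,B\Rightarrow\Delta\}$ / $G\{\Gamma,A\vee B\Rightarrow\Delta\}$; $(\vee_R)$ $G\{\Gamma\Rightarrow\Delta,A,B\}$ / $G\{\Gamma\Rightarrow\Delta,A\vee B\}$; $(\supset_L)$ $G\{\Gamma,A\supset B\Rightarrow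 A,\Delta\}$, $G\{\Gamma,B\Rightarrow\Delta\}$ / $G\{\Gamma,A\supset B\Rightarrow\Delta\}$; $(\supset_R)$ $G\{\Gamma\Rightarrow\Delta,\langle A\Rightarrow B\rangle\}$ / $G\{\Gamma\Rightarrow\Delta,A\supset B\}$; $(\square_L)$ $G\{\Gamma,\square A\Rightarrow\Delta,[\Sigma,A\Rightarrow\Pi]\}$ / $G\{\Gamma,\square A\Rightarrow\Delta,[\Sigma\Rightarrow\Pi]\}$; $(\square_R)$ $G\{\Gamma\Rightarrow\Delta,[\Rightarrow A]\}$ / $G\{\Gamma\Rightarrow\Delta,\square A\}$; $(\lozenge_L)$ $G\{\Gamma\Rightarrow\Delta,[A\Rightarrow]\}$ / $G\{\Gamma,\lozenge A\Rightarrow\Delta\}$; $(\lozenge_R)$ $G\{\Gamma\Rightarrow\Delta,\lozenge A,[\Sigma\Rightarrow\Pi,A]\}$ / $G\{\Gamma\Rightarrow\Delta,\lozenge A,[\Sigma\Rightarrow\Pi]\}$; (trans) $G\{\Gamma,\Gamma'\Rightarrow\Delta,\langle\Gamma',\Sigma\Rightarrow\Pi\rangle\}$ / $G\{\Gamma,\Gamma'\Rightarrow\Delta,\langle\Sigma\Rightarrow\Pi\rangle\}$; $(\mathrm{inter}_\rightarrow)$ $G\{\Gamma\Rightarrow\Delta,\langle\Sigma\Rightarrow\Pi,[\Lambda\Rightarrow\Theta^\flat]\rangle,[\Lambda\Rightarrow\Theta]\}$ / $G\{\Gamma\Rightarrow\Delta,\langle\Sigma\Rightarrow\Pi\rangle,[\Lambda\Rightarrow\Theta]\}$;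 $(\mathrm{inter}_\downarrow)$ $G\{\Gamma\Rightarrow\Delta,\langle\Sigma\Rightarrow\Pi,[\Lambda\Rightarrow\Theta]\rangle,[\Rightarrow\Theta^\#]\}$ / $G\{\Gamma\Rightarrow\Delta,\langle\Sigma\Rightarrow\Pi,[\Lambda\Rightarrow\Theta]\rangle\}$. A sequent is provable if it is the root of a finite tree of rule instances whose leaves are axioms. Forcing of sequents: $x\not\Vdash\emptyset$; $x\Vdash[T]$ iff $y\Vdash T$ for all $y$ with $Rxy$; $x\Vdash\langle T\rangle$ iff $x'\Vdash T$ for all $x'\geq x$; $x\Vdash\Gamma\Rightarrow\Delta$ iff $x\not\Vdash A$ for some $A\in\Gamma$ or $x\Vdash\mathcal{O}$ for some formula or block $\mathcal{O}\in\Delta$. -}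

module Defs where

open import Level using (Level; _⊔_) renaming (suc to lsuc)
open import Data.Nat using (ℕ)
open import Data.List using (List; []; _∷_; _++_)
open import Data.List.Relation.Binary.Permutation.Propositional using (_↭_)
open import Data.List.Relation.Unary.Any using (Any)
open import Data.Product using (Σ; _×_)
open import Data.Sum using (_⊎_)
open import Data.Unit.Polymorphic using (⊤)
open import Data.Empty.Polymorphic using (⊥)
open import Relation.Nullary using (¬_)

infixr 10 _⊃_
infixr 11 _∨_
infixr 12 _∧_

data Fm : Set where
  atom : ℕ → Fm
  _⊃_  : Fm → Fm → Fm
  ⊤̇    : Fm
  ⊥̇    : Fm
  _∨_  : Fm → Fm → Fm
  _∧_  : Fm → Fm → Fm
  □    : Fm → Fm
  ◇    : Fm → Fm

-- Bi-nested sequents.  Γ and Δ are multisets, represented by lists;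
-- the multiset reading is realised by the structural rule `perm`
-- below (permutation of antecedent/succedent of any nested sequent).

infix 4 _⇒_

mutual
  data Seq : Set where
    _⇒_ : List Fm → List Item → Seq

  -- items of a succedent: formulas, modal blocks [S], implication blocks ⟨S⟩
  data Item : Set where
    fm  : Fm → Item
    box : Seq → Item
    imp : Seq → Item

data Ctx : Set where
  hole  : Ctx
  impC  : List Fm → List Item → Ctx → Ctx
  boxC  : List Fm → List Item → Ctx → Ctx

infix 30 _⟪_⟫

_⟪_⟫ : Ctx → Seq → Seq
hole         ⟪ S ⟫ = S
impC Γ Δ G   ⟪ S ⟫ = Γ ⇒ Δ ++ (imp (G ⟪ S ⟫) ∷ [])
boxC Γ Δ G   ⟪ S ⟫ = Γ ⇒ Δ ++ (box (G ⟪ S ⟫) ∷ [])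

flat : List Item → List Item
flat []                   = []
flat (fm _ ∷ Θ)           = flat Θ
flat (imp _ ∷ Θ)          = flat Θ
flat (box (Φ ⇒ Ψ) ∷ Θ)    = box (Φ ⇒ flat Ψ) ∷ flat Θ

sharp : List Item → List Item
sharp []                  = []
sharp (fm A ∷ Θ)          = fm A ∷ sharp Θ
sharp (imp _ ∷ Θ)         = sharp Θ
sharp (box (Φ ⇒ Ψ) ∷ Θ)   = box ([] ⇒ sharp Ψ) ∷ sharp Θ

data Provable : Seq → Set where
  perm   : ∀ {G Γ Γ' Δ Δ'} → Γ ↭ Γ' → Δ ↭ Δ' →
           Provable (G ⟪ Γ' ⇒ Δ' ⟫) → Provable (G ⟪ Γ ⇒ Δ ⟫)
  ax⊥    : ∀ {G Γ Δ} → Provable (G ⟪ ⊥̇ ∷ Γ ⇒ Δ ⟫)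
  ax⊤    : ∀ {G Γ Δ} → Provable (G ⟪ Γ ⇒ fm ⊤̇ ∷ Δ ⟫)
  axAt   : ∀ {G Γ Δ p} → Provable (G ⟪ atom p ∷ Γ ⇒ fm (atom p) ∷ Δ ⟫)
  ∧L     : ∀ {G Γ Δ A B} → Provable (G ⟪ A ∷ B ∷ Γ ⇒ Δ ⟫) →
           Provable (G ⟪ A ∧ B ∷ Γ ⇒ Δ ⟫)
  ∧R     : ∀ {G Γ Δ A B} → Provable (G ⟪ Γ ⇒ fm A ∷ Δ ⟫) →
           Provable (G ⟪ Γ ⇒ fm B ∷ Δ ⟫) → Provable (G ⟪ Γ ⇒ fm (A ∧ B) ∷ Δ ⟫)
  ∨L     : ∀ {G Γ Δ A B} → Provable (G ⟪ A ∷ Γ ⇒ Δ ⟫) →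
           Provable (G ⟪ B ∷ Γ ⇒ Δ ⟫) → Provable (G ⟪ A ∨ B ∷ Γ ⇒ Δ ⟫)
  ∨R     : ∀ {G Γ Δ A B} → Provable (G ⟪ Γ ⇒ fm A ∷ fm B ∷ Δ ⟫) →
           Provable (G ⟪ Γ ⇒ fm (A ∨ B) ∷ Δ ⟫)
  ⊃L     : ∀ {G Γ Δ A B} → Provable (G ⟪ A ⊃ B ∷ Γ ⇒ fm A ∷ Δ ⟫) →
           Provable (G ⟪ B ∷ Γ ⇒ Δ ⟫) → Provable (G ⟪ A ⊃ B ∷ Γ ⇒ Δ ⟫)
  ⊃R     : ∀ {G Γ Δ A B} → Provable (G ⟪ Γ ⇒ imp (A ∷ [] ⇒ fm B ∷ []) ∷ Δ ⟫) →
           Provable (G ⟪ Γ ⇒ fm (A ⊃ B) ∷ Δ ⟫)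
  □L     : ∀ {G Γ Δ A Σ' Π} →
           Provable (G ⟪ □ A ∷ Γ ⇒ box (A ∷ Σ' ⇒ Π) ∷ Δ ⟫) →
           Provable (G ⟪ □ A ∷ Γ ⇒ box (Σ' ⇒ Π) ∷ Δ ⟫)
  □R     : ∀ {G Γ Δ A} → Provable (G ⟪ Γ ⇒ box ([] ⇒ fm A ∷ []) ∷ Δ ⟫) →
           Provable (G ⟪ Γ ⇒ fm (□ A) ∷ Δ ⟫)
  ◇L     : ∀ {G Γ Δ A} → Provable (G ⟪ Γ ⇒ box (A ∷ [] ⇒ []) ∷ Δ ⟫) →
           Provable (G ⟪ ◇ A ∷ Γ ⇒ Δ ⟫)
  ◇R     : ∀ {G Γ Δ A Σ' Π} →
           Provable (G ⟪ Γ ⇒ fm (◇ A) ∷ box (Σ' ⇒ fm A ∷ Π) ∷ Δ ⟫) →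
           Provable (G ⟪ Γ ⇒ fm (◇ A) ∷ box (Σ' ⇒ Π) ∷ Δ ⟫)
  trans  : ∀ {G Γ Γ' Δ Σ' Π} →
           Provable (G ⟪ Γ ++ Γ' ⇒ imp (Γ' ++ Σ' ⇒ Π) ∷ Δ ⟫) →
           Provable (G ⟪ Γ ++ Γ' ⇒ imp (Σ' ⇒ Π) ∷ Δ ⟫)
  inter→ : ∀ {G Γ Δ Σ' Π Λ Θ} →
           Provable (G ⟪ Γ ⇒ imp (Σ' ⇒ box (Λ ⇒ flat Θ) ∷ Π) ∷ box (Λ ⇒ Θ) ∷ Δ ⟫) →
           Provable (G ⟪ Γ ⇒ imp (Σ' ⇒ Π) ∷ box (Λ ⇒ Θ) ∷ Δ ⟫)
  inter↓ : ∀ {G Γ Δ Σ' Π Λ Θ} →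
           Provable (G ⟪ Γ ⇒ imp (Σ' ⇒ box (Λ ⇒ Θ) ∷ Π) ∷ box ([] ⇒ sharp Θ) ∷ Δ ⟫) →
           Provable (G ⟪ Γ ⇒ imp (Σ' ⇒ box (Λ ⇒ Θ) ∷ Π) ∷ Δ ⟫)

record Frame (ℓ : Level) : Set (lsuc ℓ) where
  field
    W        : Set ℓ
    _≤_      : W → W → Set ℓ
    R        : W → W → Set ℓ
    ≤-refl   : ∀ {x} → x ≤ x
    ≤-trans  : ∀ {x y z} → x ≤ y → y ≤ z → x ≤ z

ForwardConfluent : ∀ {ℓ} → Frame ℓ → Set ℓ
ForwardConfluent F = ∀ {x x' y} → x ≤ x' → R x y → Σ W (λ y' → R x' y' × y ≤ y')
  where open Frame F

DownwardConfluent : ∀ {ℓ} → Frame ℓ → Set ℓ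
DownwardConfluent F = ∀ {x x' y} → x ≤ x' → R x' y → Σ W (λ z → R x z × z ≤ y)
  where open Frame F

record Model (ℓ : Level) : Set (lsuc ℓ) where
  field
    frame  : Frame ℓ
  open Frame frame public
  field
    V      : ℕ → W → Set ℓ
    V-mono : ∀ {p x y} → x ≤ y → V p x → V p y

module Forcing {ℓ : Level} (M : Model ℓ) where
  open Model M

  infix 4 _⊩_
  _⊩_ : W → Fm → Set ℓ
  x ⊩ atom p  = V p x
  x ⊩ (A ⊃ B) = ∀ x' → x ≤ x' → x' ⊩ A → x' ⊩ B
  x ⊩ ⊤̇       = ⊤
  x ⊩ ⊥̇       = ⊥
  x ⊩ (A ∨ B) = x ⊩ A ⊎ x ⊩ B
  x ⊩ (A ∧ B) = x ⊩ A × x ⊩ B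
  x ⊩ □ A     = ∀ y → R x y → y ⊩ A
  x ⊩ ◇ A     = Σ W (λ y → R x y × y ⊩ A)

  mutual
    _⊩S_ : W → Seq → Set ℓ
    x ⊩S (Γ ⇒ Δ) = Any (λ A → ¬ (x ⊩ A)) Γ ⊎ x ⊩Succ Δ

    _⊩Succ_ : W → List Item → Set ℓ
    x ⊩Succ []      = ⊥
    x ⊩Succ (O ∷ Δ) = x ⊩I O ⊎ x ⊩Succ Δ

    _⊩I_ : W → Item → Set ℓ
    x ⊩I fm A  = x ⊩ A
    x ⊩I box T = ∀ y → R x y → y ⊩S T
    x ⊩I imp T = ∀ x' → x ≤ x' → x' ⊩S T

-- Soundness is proved rule by rule, and every rule is local: at each world, forcing of
-- its premises implies forcing of its conclusion. This suffices because a context G{ }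
-- acts on the set of worlds forcing the sequent in its hole by a monotone, meet-preserving
-- operator, through which pointwise implications lift. Both confluence conditions are
-- needed for persistence of formula forcing along ≤; beyond that, forward confluence
-- transports a block [Λ ⇒ Θ♭] backwards along ≤ (inter→) and downward confluence a block
-- [⇒ Θ#] forwards (inter↓). Since forcing of a sequent is a disjunction, the rules whose
-- soundness branches on the truth of a formula use excluded middle.
module Submission where

open import Defs
open import Axiom.ExcludedMiddle using (ExcludedMiddle)
open import Level using (Level; lift)
open import Function using (_∘_; id)
open import Data.List using ([]; _∷_; _++_)
open import Data.List.Relation.Unary.Any using (Any; here; there)
import Data.List.Relation.Unary.Any as Any
open import Data.List.Relation.Unary.Any.Properties using (++⁻; ++⁺ˡ; ++⁺ʳ)
open import Data.List.Relation.Unary.All using (All)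
import Data.List.Relation.Unary.All as All
open import Data.List.Relation.Unary.All.Properties using (¬All⇒Any¬; Any¬⇒¬All)
open import Data.List.Relation.Binary.Permutation.Propositional using (_↭_; ↭-sym)
open import Data.List.Relation.Binary.Permutation.Propositional.Properties using (Any-resp-↭)
open import Data.Product using (_×_; _,_; proj₁; proj₂; uncurry)
open import Data.Sum using (_⊎_; inj₁; inj₂; [_,_]′)
import Data.Sum as Sum
open import Data.Unit.Polymorphic using (tt)
open import Data.Empty using (⊥-elim)
open import Relation.Nullary using (¬_; yes; no)

module Soundness {ℓ : Level} (M : Model ℓ) where
  open Model M
  open Forcing M

  ⊩Succ⇒Any : ∀ {x Δ} → x ⊩Succ Δ → Any (x ⊩I_) Δ
  ⊩Succ⇒Any {Δ = O ∷ Δ} (inj₁ o) = here o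
  ⊩Succ⇒Any {Δ = O ∷ Δ} (inj₂ s) = there (⊩Succ⇒Any s)

  Any⇒⊩Succ : ∀ {x Δ} → Any (x ⊩I_) Δ → x ⊩Succ Δ
  Any⇒⊩Succ (here o)  = inj₁ o
  Any⇒⊩Succ (there a) = inj₂ (Any⇒⊩Succ a)

  ⊩S-resp-↭ : ∀ {x Γ Γ' Δ Δ'} → Γ ↭ Γ' → Δ ↭ Δ' → x ⊩S (Γ ⇒ Δ) → x ⊩S (Γ' ⇒ Δ')
  ⊩S-resp-↭ p q = Sum.map (Any-resp-↭ p) (Any⇒⊩Succ ∘ Any-resp-↭ q ∘ ⊩Succ⇒Any)

  ⊩S-snoc⁻ : ∀ Γ Δ {O x} → x ⊩S (Γ ⇒ Δ ++ O ∷ []) → x ⊩S (Γ ⇒ Δ) ⊎ x ⊩I O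
  ⊩S-snoc⁻ Γ Δ (inj₁ a) = inj₁ (inj₁ a)
  ⊩S-snoc⁻ Γ Δ (inj₂ s) with ++⁻ Δ (⊩Succ⇒Any s)
  ... | inj₁ a        = inj₁ (inj₂ (Any⇒⊩Succ a))
  ... | inj₂ (here o) = inj₂ o

  ⊩S-snoc⁺ : ∀ Γ Δ {O x} → x ⊩S (Γ ⇒ Δ) ⊎ x ⊩I O → x ⊩S (Γ ⇒ Δ ++ O ∷ [])
  ⊩S-snoc⁺ Γ Δ (inj₁ (inj₁ a)) = inj₁ a
  ⊩S-snoc⁺ Γ Δ (inj₁ (inj₂ s)) = inj₂ (Any⇒⊩Succ (++⁺ˡ (⊩Succ⇒Any s)))
  ⊩S-snoc⁺ Γ Δ (inj₂ o)        = inj₂ (Any⇒⊩Succ (++⁺ʳ Δ (here o)))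

  ⟦_⟧ : Ctx → (W → Set ℓ) → W → Set ℓ
  ⟦ hole ⟧       P x = P x
  ⟦ impC Γ Δ G ⟧ P x = x ⊩S (Γ ⇒ Δ) ⊎ (∀ x' → x ≤ x' → ⟦ G ⟧ P x')
  ⟦ boxC Γ Δ G ⟧ P x = x ⊩S (Γ ⇒ Δ) ⊎ (∀ y → R x y → ⟦ G ⟧ P y)

  ⟪⟫⇒⟦⟧ : ∀ G {S x} → x ⊩S G ⟪ S ⟫ → ⟦ G ⟧ (_⊩S S) x
  ⟪⟫⇒⟦⟧ hole         s = s
  ⟪⟫⇒⟦⟧ (impC Γ Δ G) s = Sum.map id (λ f x' x≤x' → ⟪⟫⇒⟦⟧ G (f x' x≤x')) (⊩S-snoc⁻ Γ Δ s)
  ⟪⟫⇒⟦⟧ (boxC Γ Δ G) s = Sum.map id (λ f y Rxy → ⟪⟫⇒⟦⟧ G (f y Rxy)) (⊩S-snoc⁻ Γ Δ s)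

  ⟦⟧⇒⟪⟫ : ∀ G {S x} → ⟦ G ⟧ (_⊩S S) x → x ⊩S G ⟪ S ⟫
  ⟦⟧⇒⟪⟫ hole         s = s
  ⟦⟧⇒⟪⟫ (impC Γ Δ G) s = ⊩S-snoc⁺ Γ Δ (Sum.map id (λ f x' x≤x' → ⟦⟧⇒⟪⟫ G (f x' x≤x')) s)
  ⟦⟧⇒⟪⟫ (boxC Γ Δ G) s = ⊩S-snoc⁺ Γ Δ (Sum.map id (λ f y Rxy → ⟦⟧⇒⟪⟫ G (f y Rxy)) s)

  ⟦⟧-map : ∀ G {P Q : W → Set ℓ} → (∀ {x} → P x → Q x) → ∀ {x} → ⟦ G ⟧ P x → ⟦ G ⟧ Q x
  ⟦⟧-map hole         f p = f p
  ⟦⟧-map (impC Γ Δ G) f p = Sum.map id (λ g x' x≤x' → ⟦⟧-map G f (g x' x≤x')) p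
  ⟦⟧-map (boxC Γ Δ G) f p = Sum.map id (λ g y Rxy → ⟦⟧-map G f (g y Rxy)) p

  ⟦⟧-zip : ∀ G {P Q : W → Set ℓ} {x} → ⟦ G ⟧ P x → ⟦ G ⟧ Q x → ⟦ G ⟧ (λ y → P y × Q y) x
  ⟦⟧-zip hole         p        q        = p , q
  ⟦⟧-zip (impC Γ Δ G) (inj₁ s) _        = inj₁ s
  ⟦⟧-zip (impC Γ Δ G) (inj₂ _) (inj₁ s) = inj₁ s
  ⟦⟧-zip (impC Γ Δ G) (inj₂ f) (inj₂ g) = inj₂ (λ x' x≤x' → ⟦⟧-zip G (f x' x≤x') (g x' x≤x'))
  ⟦⟧-zip (boxC Γ Δ G) (inj₁ s) _        = inj₁ s
  ⟦⟧-zip (boxC Γ Δ G) (inj₂ _) (inj₁ s) = inj₁ s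
  ⟦⟧-zip (boxC Γ Δ G) (inj₂ f) (inj₂ g) = inj₂ (λ y Rxy → ⟦⟧-zip G (f y Rxy) (g y Rxy))

  ⟦⟧-valid : ∀ G {P : W → Set ℓ} → (∀ x → P x) → ∀ x → ⟦ G ⟧ P x
  ⟦⟧-valid hole         p x = p x
  ⟦⟧-valid (impC Γ Δ G) p x = inj₂ (λ x' _ → ⟦⟧-valid G p x')
  ⟦⟧-valid (boxC Γ Δ G) p x = inj₂ (λ y _ → ⟦⟧-valid G p y)

  ⟪⟫-map : ∀ G {S₁ S₂} → (∀ {x} → x ⊩S S₁ → x ⊩S S₂) → ∀ {x} → x ⊩S G ⟪ S₁ ⟫ → x ⊩S G ⟪ S₂ ⟫
  ⟪⟫-map G f = ⟦⟧⇒⟪⟫ G ∘ ⟦⟧-map G f ∘ ⟪⟫⇒⟦⟧ G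

  ⟪⟫-map₂ : ∀ G {S₁ S₂ S₃} → (∀ {x} → x ⊩S S₁ → x ⊩S S₂ → x ⊩S S₃) →
            ∀ {x} → x ⊩S G ⟪ S₁ ⟫ → x ⊩S G ⟪ S₂ ⟫ → x ⊩S G ⟪ S₃ ⟫
  ⟪⟫-map₂ G f s t = ⟦⟧⇒⟪⟫ G (⟦⟧-map G (uncurry f) (⟦⟧-zip G (⟪⟫⇒⟦⟧ G s) (⟪⟫⇒⟦⟧ G t)))

  ⟪⟫-valid : ∀ G {S} → (∀ x → x ⊩S S) → ∀ x → x ⊩S G ⟪ S ⟫
  ⟪⟫-valid G v x = ⟦⟧⇒⟪⟫ G (⟦⟧-valid G v x)

  ⊩-ax⊥ : ∀ {Γ Δ} x → x ⊩S (⊥̇ ∷ Γ ⇒ Δ)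
  ⊩-ax⊥ _ = inj₁ (here λ { (lift ()) })

  ⊩-ax⊤ : ∀ {Γ Δ} x → x ⊩S (Γ ⇒ fm ⊤̇ ∷ Δ)
  ⊩-ax⊤ _ = inj₂ (inj₁ tt)

  ⊩-∧L : ∀ {Γ Δ A B x} → x ⊩S (A ∷ B ∷ Γ ⇒ Δ) → x ⊩S (A ∧ B ∷ Γ ⇒ Δ)
  ⊩-∧L (inj₁ (here ¬a))         = inj₁ (here (¬a ∘ proj₁))
  ⊩-∧L (inj₁ (there (here ¬b))) = inj₁ (here (¬b ∘ proj₂))
  ⊩-∧L (inj₁ (there (there r))) = inj₁ (there r)
  ⊩-∧L (inj₂ s)                 = inj₂ s

  ⊩-∧R : ∀ {Γ Δ A B x} →
         x ⊩S (Γ ⇒ fm A ∷ Δ) → x ⊩S (Γ ⇒ fm B ∷ Δ) → x ⊩S (Γ ⇒ fm (A ∧ B) ∷ Δ)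
  ⊩-∧R (inj₁ r)        _               = inj₁ r
  ⊩-∧R (inj₂ (inj₂ s)) _               = inj₂ (inj₂ s)
  ⊩-∧R (inj₂ (inj₁ _)) (inj₁ r)        = inj₁ r
  ⊩-∧R (inj₂ (inj₁ _)) (inj₂ (inj₂ s)) = inj₂ (inj₂ s)
  ⊩-∧R (inj₂ (inj₁ a)) (inj₂ (inj₁ b)) = inj₂ (inj₁ (a , b))

  ⊩-∨L : ∀ {Γ Δ A B x} → x ⊩S (A ∷ Γ ⇒ Δ) → x ⊩S (B ∷ Γ ⇒ Δ) → x ⊩S (A ∨ B ∷ Γ ⇒ Δ)
  ⊩-∨L (inj₁ (there r)) _                = inj₁ (there r)
  ⊩-∨L (inj₂ s)         _                = inj₂ s
  ⊩-∨L (inj₁ (here _))  (inj₁ (there r)) = inj₁ (there r)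
  ⊩-∨L (inj₁ (here _))  (inj₂ s)         = inj₂ s
  ⊩-∨L (inj₁ (here ¬a)) (inj₁ (here ¬b)) = inj₁ (here [ ¬a , ¬b ]′)

  ⊩-∨R : ∀ {Γ Δ A B x} → x ⊩S (Γ ⇒ fm A ∷ fm B ∷ Δ) → x ⊩S (Γ ⇒ fm (A ∨ B) ∷ Δ)
  ⊩-∨R (inj₁ r)               = inj₁ r
  ⊩-∨R (inj₂ (inj₁ a))        = inj₂ (inj₁ (inj₁ a))
  ⊩-∨R (inj₂ (inj₂ (inj₁ b))) = inj₂ (inj₁ (inj₂ b))
  ⊩-∨R (inj₂ (inj₂ (inj₂ s))) = inj₂ (inj₂ s)

  ⊩-⊃L : ∀ {Γ Δ A B x} →
         x ⊩S (A ⊃ B ∷ Γ ⇒ fm A ∷ Δ) → x ⊩S (B ∷ Γ ⇒ Δ) → x ⊩S (A ⊃ B ∷ Γ ⇒ Δ)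
  ⊩-⊃L (inj₁ r)        _                = inj₁ r
  ⊩-⊃L (inj₂ (inj₂ s)) _                = inj₂ s
  ⊩-⊃L (inj₂ (inj₁ _)) (inj₁ (there r)) = inj₁ (there r)
  ⊩-⊃L (inj₂ (inj₁ _)) (inj₂ s)         = inj₂ s
  ⊩-⊃L (inj₂ (inj₁ a)) (inj₁ (here ¬b)) = inj₁ (here (λ f → ¬b (f _ ≤-refl a)))

  ⊩-⊃R : ∀ {Γ Δ A B x} →
         x ⊩S (Γ ⇒ imp (A ∷ [] ⇒ fm B ∷ []) ∷ Δ) → x ⊩S (Γ ⇒ fm (A ⊃ B) ∷ Δ)
  ⊩-⊃R (inj₁ r)        = inj₁ r
  ⊩-⊃R (inj₂ (inj₂ s)) = inj₂ (inj₂ s)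
  ⊩-⊃R {A = A} {B} (inj₂ (inj₁ f)) = inj₂ (inj₁ (λ x' x≤x' → modus-ponens (f x' x≤x')))
    where
    modus-ponens : ∀ {x} → x ⊩S (A ∷ [] ⇒ fm B ∷ []) → x ⊩ A → x ⊩ B
    modus-ponens (inj₁ (here ¬a)) a = ⊥-elim (¬a a)
    modus-ponens (inj₂ (inj₁ b))  _ = b

  ⊩-□R : ∀ {Γ Δ A x} → x ⊩S (Γ ⇒ box ([] ⇒ fm A ∷ []) ∷ Δ) → x ⊩S (Γ ⇒ fm (□ A) ∷ Δ)
  ⊩-□R (inj₁ r)        = inj₁ r
  ⊩-□R (inj₂ (inj₂ s)) = inj₂ (inj₂ s)
  ⊩-□R {A = A} (inj₂ (inj₁ f)) = inj₂ (inj₁ (λ y Rxy → conclusion (f y Rxy)))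
    where
    conclusion : ∀ {y} → y ⊩S ([] ⇒ fm A ∷ []) → y ⊩ A
    conclusion (inj₂ (inj₁ a)) = a

  ⊩-◇L : ∀ {Γ Δ A x} → x ⊩S (Γ ⇒ box (A ∷ [] ⇒ []) ∷ Δ) → x ⊩S (◇ A ∷ Γ ⇒ Δ)
  ⊩-◇L (inj₁ r)        = inj₁ (there r)
  ⊩-◇L (inj₂ (inj₂ s)) = inj₂ s
  ⊩-◇L {A = A} (inj₂ (inj₁ f)) = inj₁ (here (λ (y , Rxy , a) → refutation (f y Rxy) a))
    where
    refutation : ∀ {y} → y ⊩S (A ∷ [] ⇒ []) → ¬ (y ⊩ A)
    refutation (inj₁ (here ¬a)) = ¬a

  module _ (fc : ForwardConfluent frame) (dc : DownwardConfluent frame) where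

    ⊩-mono : ∀ A {x x'} → x ≤ x' → x ⊩ A → x' ⊩ A
    ⊩-mono (atom p) x≤x' v             = V-mono x≤x' v
    ⊩-mono (A ⊃ B)  x≤x' f             = λ x'' x'≤x'' → f x'' (≤-trans x≤x' x'≤x'')
    ⊩-mono ⊤̇        x≤x' _             = tt
    ⊩-mono ⊥̇        x≤x' ()
    ⊩-mono (A ∨ B)  x≤x' (inj₁ a)      = inj₁ (⊩-mono A x≤x' a)
    ⊩-mono (A ∨ B)  x≤x' (inj₂ b)      = inj₂ (⊩-mono B x≤x' b)
    ⊩-mono (A ∧ B)  x≤x' (a , b)       = ⊩-mono A x≤x' a , ⊩-mono B x≤x' b
    ⊩-mono (□ A)    x≤x' f y Rx'y      =
      let z , Rxz , z≤y = dc x≤x' Rx'y in ⊩-mono A z≤y (f z Rxz)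
    ⊩-mono (◇ A)    x≤x' (y , Rxy , a) =
      let y' , Rx'y' , y≤y' = fc x≤x' Rxy in y' , Rx'y' , ⊩-mono A y≤y' a

    mutual
      ⊩box-flat : ∀ {Λ Θ x x'} → x ≤ x' → x' ⊩I box (Λ ⇒ flat Θ) → x ⊩I box (Λ ⇒ Θ)
      ⊩box-flat x≤x' f y Rxy =
        let y' , Rx'y' , y≤y' = fc x≤x' Rxy in ⊩S-flat y≤y' (f y' Rx'y')

      ⊩S-flat : ∀ {Λ Θ y y'} → y ≤ y' → y' ⊩S (Λ ⇒ flat Θ) → y ⊩S (Λ ⇒ Θ)
      ⊩S-flat y≤y' (inj₁ r) = inj₁ (Any.map (λ {A} ¬a a → ¬a (⊩-mono A y≤y' a)) r)
      ⊩S-flat y≤y' (inj₂ s) = inj₂ (⊩Succ-flat y≤y' s)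

      ⊩Succ-flat : ∀ {Θ y y'} → y ≤ y' → y' ⊩Succ flat Θ → y ⊩Succ Θ
      ⊩Succ-flat {fm _ ∷ Θ}        y≤y' s        = inj₂ (⊩Succ-flat y≤y' s)
      ⊩Succ-flat {imp _ ∷ Θ}       y≤y' s        = inj₂ (⊩Succ-flat y≤y' s)
      ⊩Succ-flat {box (_ ⇒ _) ∷ Θ} y≤y' (inj₁ f) = inj₁ (⊩box-flat y≤y' f)
      ⊩Succ-flat {box (_ ⇒ _) ∷ Θ} y≤y' (inj₂ s) = inj₂ (⊩Succ-flat y≤y' s)

    mutual
      ⊩box-sharp : ∀ {Λ Θ x x'} → x ≤ x' → x ⊩I box ([] ⇒ sharp Θ) → x' ⊩I box (Λ ⇒ Θ)
      ⊩box-sharp x≤x' f y Rx'y with dc x≤x' Rx'y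
      ... | z , Rxz , z≤y with f z Rxz
      ...   | inj₂ s = inj₂ (⊩Succ-sharp z≤y s)

      ⊩Succ-sharp : ∀ {Θ z y} → z ≤ y → z ⊩Succ sharp Θ → y ⊩Succ Θ
      ⊩Succ-sharp {fm A ∷ Θ}        z≤y (inj₁ a) = inj₁ (⊩-mono A z≤y a)
      ⊩Succ-sharp {fm _ ∷ Θ}        z≤y (inj₂ s) = inj₂ (⊩Succ-sharp z≤y s)
      ⊩Succ-sharp {imp _ ∷ Θ}       z≤y s        = inj₂ (⊩Succ-sharp z≤y s)
      ⊩Succ-sharp {box (_ ⇒ _) ∷ Θ} z≤y (inj₁ f) = inj₁ (⊩box-sharp z≤y f)
      ⊩Succ-sharp {box (_ ⇒ _) ∷ Θ} z≤y (inj₂ s) = inj₂ (⊩Succ-sharp z≤y s)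

    ⊩-inter↓ : ∀ {Γ Δ Σ' Π Λ Θ x} →
               x ⊩S (Γ ⇒ imp (Σ' ⇒ box (Λ ⇒ Θ) ∷ Π) ∷ box ([] ⇒ sharp Θ) ∷ Δ) →
               x ⊩S (Γ ⇒ imp (Σ' ⇒ box (Λ ⇒ Θ) ∷ Π) ∷ Δ)
    ⊩-inter↓ (inj₁ r)               = inj₁ r
    ⊩-inter↓ (inj₂ (inj₁ f))        = inj₂ (inj₁ f)
    ⊩-inter↓ (inj₂ (inj₂ (inj₂ s))) = inj₂ (inj₂ s)
    ⊩-inter↓ (inj₂ (inj₂ (inj₁ b))) = inj₂ (inj₁ λ x' x≤x' → inj₂ (inj₁ (⊩box-sharp x≤x' b)))

    module _ (em : ExcludedMiddle ℓ) where

      all-or-refuted : ∀ {x} Γ → All (x ⊩_) Γ ⊎ Any (λ A → ¬ (x ⊩ A)) Γ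
      all-or-refuted {x} Γ with em {All (x ⊩_) Γ}
      ... | yes all = inj₁ all
      ... | no ¬all = inj₂ (¬All⇒Any¬ (λ _ → em) Γ ¬all)

      ⊩-axAt : ∀ {Γ Δ p} x → x ⊩S (atom p ∷ Γ ⇒ fm (atom p) ∷ Δ)
      ⊩-axAt {p = p} x with em {V p x}
      ... | yes v = inj₂ (inj₁ v)
      ... | no ¬v = inj₁ (here ¬v)

      ⊩-□L : ∀ {Γ Δ A Σ' Π x} →
             x ⊩S (□ A ∷ Γ ⇒ box (A ∷ Σ' ⇒ Π) ∷ Δ) → x ⊩S (□ A ∷ Γ ⇒ box (Σ' ⇒ Π) ∷ Δ)
      ⊩-□L (inj₁ r)        = inj₁ r
      ⊩-□L (inj₂ (inj₂ s)) = inj₂ (inj₂ s)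
      ⊩-□L {A = A} {Σ'} {Π} {x} (inj₂ (inj₁ f)) with em {x ⊩ □ A}
      ... | no ¬□a = inj₁ (here ¬□a)
      ... | yes □a = inj₂ (inj₁ (λ y Rxy → discharge (□a y Rxy) (f y Rxy)))
        where
        discharge : ∀ {y} → y ⊩ A → y ⊩S (A ∷ Σ' ⇒ Π) → y ⊩S (Σ' ⇒ Π)
        discharge a (inj₁ (here ¬a)) = ⊥-elim (¬a a)
        discharge a (inj₁ (there r)) = inj₁ r
        discharge a (inj₂ s)         = inj₂ s

      ⊩-◇R : ∀ {Γ Δ A Σ' Π x} →
             x ⊩S (Γ ⇒ fm (◇ A) ∷ box (Σ' ⇒ fm A ∷ Π) ∷ Δ) →
             x ⊩S (Γ ⇒ fm (◇ A) ∷ box (Σ' ⇒ Π) ∷ Δ)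
      ⊩-◇R (inj₁ r)               = inj₁ r
      ⊩-◇R (inj₂ (inj₁ ◇a))       = inj₂ (inj₁ ◇a)
      ⊩-◇R (inj₂ (inj₂ (inj₂ s))) = inj₂ (inj₂ (inj₂ s))
      ⊩-◇R {A = A} {Σ'} {Π} {x} (inj₂ (inj₂ (inj₁ f))) with em {x ⊩ ◇ A}
      ... | yes ◇a = inj₂ (inj₁ ◇a)
      ... | no ¬◇a = inj₂ (inj₂ (inj₁ λ y Rxy → drop-A y Rxy (f y Rxy)))
        where
        drop-A : ∀ y → R x y → y ⊩S (Σ' ⇒ fm A ∷ Π) → y ⊩S (Σ' ⇒ Π)
        drop-A y Rxy (inj₁ r)        = inj₁ r
        drop-A y Rxy (inj₂ (inj₁ a)) = ⊥-elim (¬◇a (y , Rxy , a))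
        drop-A y Rxy (inj₂ (inj₂ s)) = inj₂ s

      ⊩-trans : ∀ {Γ Γ' Δ Σ' Π x} →
                x ⊩S (Γ ++ Γ' ⇒ imp (Γ' ++ Σ' ⇒ Π) ∷ Δ) →
                x ⊩S (Γ ++ Γ' ⇒ imp (Σ' ⇒ Π) ∷ Δ)
      ⊩-trans (inj₁ r)        = inj₁ r
      ⊩-trans (inj₂ (inj₂ s)) = inj₂ (inj₂ s)
      ⊩-trans {Γ} {Γ'} {Σ' = Σ'} {Π} (inj₂ (inj₁ f)) with all-or-refuted Γ'
      ... | inj₂ r  = inj₁ (++⁺ʳ Γ r)
      ... | inj₁ γ' = inj₂ (inj₁ λ x' x≤x' →
                        discharge (All.map (λ {A} → ⊩-mono A x≤x') γ') (f x' x≤x'))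
        where
        discharge : ∀ {y} → All (y ⊩_) Γ' → y ⊩S (Γ' ++ Σ' ⇒ Π) → y ⊩S (Σ' ⇒ Π)
        discharge γ' (inj₁ r) = inj₁ ([ (λ r' → ⊥-elim (Any¬⇒¬All r' γ')) , id ]′ (++⁻ Γ' r))
        discharge γ' (inj₂ s) = inj₂ s

      ⊩-inter→ : ∀ {Γ Δ Σ' Π Λ Θ x} →
                 x ⊩S (Γ ⇒ imp (Σ' ⇒ box (Λ ⇒ flat Θ) ∷ Π) ∷ box (Λ ⇒ Θ) ∷ Δ) →
                 x ⊩S (Γ ⇒ imp (Σ' ⇒ Π) ∷ box (Λ ⇒ Θ) ∷ Δ)
      ⊩-inter→ (inj₁ r)        = inj₁ r
      ⊩-inter→ (inj₂ (inj₂ s)) = inj₂ (inj₂ s)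
      ⊩-inter→ {Σ' = Σ'} {Π} {Λ} {Θ} {x} (inj₂ (inj₁ f)) with em {x ⊩I box (Λ ⇒ Θ)}
      ... | yes b = inj₂ (inj₂ (inj₁ b))
      ... | no ¬b = inj₂ (inj₁ λ x' x≤x' → drop-block x≤x' (f x' x≤x'))
        where
        drop-block : ∀ {x'} → x ≤ x' → x' ⊩S (Σ' ⇒ box (Λ ⇒ flat Θ) ∷ Π) → x' ⊩S (Σ' ⇒ Π)
        drop-block _    (inj₁ r)         = inj₁ r
        drop-block x≤x' (inj₂ (inj₁ b')) = ⊥-elim (¬b (⊩box-flat x≤x' b'))
        drop-block _    (inj₂ (inj₂ s))  = inj₂ s

      -- Rule data that forcing does not expose to unification (formulas in succedents,
      -- which _⊩Succ_ unfolds, and the split Γ ++ Γ' in trans) is passed explicitly.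
      sound : ∀ {S} → Provable S → ∀ x → x ⊩S S
      sound (perm {G} p q d) x         = ⟪⟫-map G (⊩S-resp-↭ (↭-sym p) (↭-sym q)) (sound d x)
      sound (ax⊥ {G})                  = ⟪⟫-valid G ⊩-ax⊥
      sound (ax⊤ {G})                  = ⟪⟫-valid G ⊩-ax⊤
      sound (axAt {G})                 = ⟪⟫-valid G ⊩-axAt
      sound (∧L {G} d) x               = ⟪⟫-map G ⊩-∧L (sound d x)
      sound (∧R {G} {A = A} {B} d e) x = ⟪⟫-map₂ G (⊩-∧R {A = A} {B}) (sound d x) (sound e x)
      sound (∨L {G} d e) x             = ⟪⟫-map₂ G ⊩-∨L (sound d x) (sound e x)
      sound (∨R {G} {A = A} {B} d) x   = ⟪⟫-map G (⊩-∨R {A = A} {B}) (sound d x)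
      sound (⊃L {G} d e) x             = ⟪⟫-map₂ G ⊩-⊃L (sound d x) (sound e x)
      sound (⊃R {G} {A = A} {B} d) x   = ⟪⟫-map G (⊩-⊃R {A = A} {B}) (sound d x)
      sound (□L {G} d) x               = ⟪⟫-map G ⊩-□L (sound d x)
      sound (□R {G} {A = A} d) x       = ⟪⟫-map G (⊩-□R {A = A}) (sound d x)
      sound (◇L {G} d) x               = ⟪⟫-map G ⊩-◇L (sound d x)
      sound (◇R {G} {A = A} d) x       = ⟪⟫-map G (⊩-◇R {A = A}) (sound d x)
      sound (trans {G} {Γ} d) x        = ⟪⟫-map G (⊩-trans {Γ}) (sound d x)
      sound (inter→ {G} d) x           = ⟪⟫-map G ⊩-inter→ (sound d x)
      sound (inter↓ {G} d) x           = ⟪⟫-map G ⊩-inter↓ (sound d x)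

theorem3 : ∀ {ℓ} → ExcludedMiddle ℓ →
    (S : Seq) → Provable S →
    (M : Model ℓ) → ForwardConfluent (Model.frame M) → DownwardConfluent (Model.frame M) →
    (x : Model.W M) → Forcing._⊩S_ M x S
theorem3 em S d M fc dc = Soundness.sound M fc dc em d
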